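{- For every formula $\phi$: $\phi$ is derivable in the natural deduction system $\mathsf{NK}^\pm$ from no assumptions if and only if $\phi$ is a classical tautology, i.e. $v(\phi)=1$ for every valuation $v$.
   Context: Let $\mathbb{C}$ be a denumerable set of contents and $\mathbb{L} = \{c^+, c^- : c \in \mathbb{C}\}$ the set of literals. Formulas: every literal; $\bot$; $\top$; and $\phi\land\psi$, $\phi\lor\psi$, $\phi\to\psi$ for formulas $\phi,\psi$. Duality $(-)^\bot$: $(c^+)^\bot = c^-$, $(c^-)^\bot = c^+$, $\bot^\bot=\top$, $\top^\bot=\bot$, $(\phi\land\psi)^\bot=\phi^\bot\lor\psi^\bot$, $(\phi\lor\psi)^\bot=\phi^\bot\land\psi^\bot$, $(\phi\to\psi)^\bot=\phi\land\psi^\bot$. A valuation is $v:\mathbb{L}\to\{0,1\}$ with $v(c^-)=1-v(c^+)$, extended by $v(\bot)=0$, $v(\top)=1$, $v(\phi\land\psi)=\min$, $v(\phi\lor\psi)=\max$, $v(\phi\to\psi)=\max\{1-v(\phi),v(\psi)\}$. The system $\mathsf{NK}^\pm$ is the Gentzen-style natural deduction system (with assumption discharge) with rules: $\top$-introduction (infer $\top$ from nothing); $\bot$-elimination (from $\bot$ infer any $\phi$); $\to$-introduction (from a derivation of $\psi$ from assumption $[\phi]$, infer $\phi\to\psi$, discharging $\phi$); $\to$-elimination (from $\phi\to\psi$ and $\phi$ infer $\psi$); $\land$-introduction (from $\phi$ and $\psi$ infer $\phi\land\psi$); $\land$-eliminations (from $\phi_1\land\phi_2$ infer $\phi_1$,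 resp. $\phi_2$); $\lor$-introductions (from $\phi_1$, resp. $\phi_2$, infer $\phi_1\lor\phi_2$); $\lor$-elimination (from $\phi_1\lor\phi_2$, a derivation of $\psi$ from $[\phi_1]$ and a derivation of $\psi$ from $[\phi_2]$, infer $\psi$, discharging); DM (from a derivation of $\bot$ from assumption $[\phi]$, infer $\phi^\bot$, discharging $\phi$); EXC (from $\phi$ and $\phi^\bot$ infer $\bot$). -}

module Defs where

open import Data.Nat using (ℕ)
open import Data.Bool using (Bool; true; false; not; _∧_; _∨_)
open import Data.List using (List; _∷_; [])
open import Data.List.Membership.Propositional using (_∈_)
open import Relation.Binary.PropositionalEquality using (_≡_)

Content : Set
Content = ℕ

data Literal : Set where
  _⁺ : Content → Literal
  _⁻ : Content → Literal

data Formula : Set where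
  lit : Literal → Formula
  ⊥ᶠ  : Formula
  ⊤ᶠ  : Formula
  _∧ᶠ_ : Formula → Formula → Formula
  _∨ᶠ_ : Formula → Formula → Formula
  _⇒_ : Formula → Formula → Formula

dual : Formula → Formula
dual (lit (c ⁺)) = lit (c ⁻)
dual (lit (c ⁻)) = lit (c ⁺)
dual ⊥ᶠ = ⊤ᶠ
dual ⊤ᶠ = ⊥ᶠ
dual (φ ∧ᶠ ψ) = dual φ ∨ᶠ dual ψ
dual (φ ∨ᶠ ψ) = dual φ ∧ᶠ dual ψ
dual (φ ⇒ ψ) = φ ∧ᶠ dual ψ

-- Valuations: v : 𝕃 → {0,1} with v(c⁻) = 1 - v(c⁺); such a v is
-- determined by (and determines) its values on positive literals,
-- so a valuation is given as a function Content → Bool (true = 1).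
Valuation : Set
Valuation = Content → Bool

valLit : Valuation → Literal → Bool
valLit v (c ⁺) = v c
valLit v (c ⁻) = not (v c)

eval : Valuation → Formula → Bool
eval v (lit l) = valLit v l
eval v ⊥ᶠ = false
eval v ⊤ᶠ = true
eval v (φ ∧ᶠ ψ) = eval v φ ∧ eval v ψ
eval v (φ ∨ᶠ ψ) = eval v φ ∨ eval v ψ
eval v (φ ⇒ ψ) = not (eval v φ) ∨ eval v ψ

Tautology : Formula → Set
Tautology φ = ∀ (v : Valuation) → eval v φ ≡ true

-- Natural deduction NK^± in context form: Γ ⊢ φ means φ is derivable
-- with open (undischarged) assumptions among Γ.
infix 4 _⊢_
data _⊢_ (Γ : List Formula) : Formula → Set where
  assum : ∀ {φ} → φ ∈ Γ → Γ ⊢ φ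
  ⊤I    : Γ ⊢ ⊤ᶠ
  ⊥E    : ∀ {φ} → Γ ⊢ ⊥ᶠ → Γ ⊢ φ
  ⇒I    : ∀ {φ ψ} → (φ ∷ Γ) ⊢ ψ → Γ ⊢ φ ⇒ ψ
  ⇒E    : ∀ {φ ψ} → Γ ⊢ φ ⇒ ψ → Γ ⊢ φ → Γ ⊢ ψ
  ∧I    : ∀ {φ ψ} → Γ ⊢ φ → Γ ⊢ ψ → Γ ⊢ φ ∧ᶠ ψ
  ∧E₁   : ∀ {φ ψ} → Γ ⊢ φ ∧ᶠ ψ → Γ ⊢ φ
  ∧E₂   : ∀ {φ ψ} → Γ ⊢ φ ∧ᶠ ψ → Γ ⊢ ψ
  ∨I₁   : ∀ {φ ψ} → Γ ⊢ φ → Γ ⊢ φ ∨ᶠ ψ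
  ∨I₂   : ∀ {φ ψ} → Γ ⊢ ψ → Γ ⊢ φ ∨ᶠ ψ
  ∨E    : ∀ {φ ψ χ} → Γ ⊢ φ ∨ᶠ ψ → (φ ∷ Γ) ⊢ χ → (ψ ∷ Γ) ⊢ χ → Γ ⊢ χ
  DM    : ∀ {φ} → (φ ∷ Γ) ⊢ ⊥ᶠ → Γ ⊢ dual φ
  EXC   : ∀ {φ} → Γ ⊢ φ → Γ ⊢ dual φ → Γ ⊢ ⊥ᶠ

{-# OPTIONS --safe #-}
-- Soundness is the usual induction over derivations, using that v(φ^⊥) = 1 − v(φ).
-- Completeness follows Kalmár: if Γ contains, for each content c of φ, the literal
-- c⁺ or c⁻ that v makes true, then Γ derives φ or φ^⊥, whichever v makes true.
-- For a tautology every such Γ derives φ, and the contents are discharged one at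
-- a time by ∨-elimination on c⁺ ∨ c⁻, which DM and EXC derive.
module Submission where

open import Defs
open import Data.Bool using (Bool; true; false; not; _∧_; _∨_; if_then_else_)
open import Data.Bool.Properties
  using (not-involutive; not-injective; ∧-conicalˡ; ∧-conicalʳ; ∨-zeroʳ; ∨-∧-booleanAlgebra)
open import Data.List using (List; []; _∷_; _++_; map)
open import Data.List.Membership.Propositional.Properties using (∈-map⁺; ∈-map⁻)
open import Data.List.Relation.Binary.Subset.Propositional using (_⊆_)
open import Data.List.Relation.Binary.Subset.Propositional.Properties
  using (⊆-refl; ∷⁺ʳ; xs⊆x∷xs; xs⊆xs++ys; xs⊆ys++xs; map⁺)
open import Data.List.Relation.Unary.All using (All; []; _∷_; lookup)
open import Data.List.Relation.Unary.Any using (here; there; tail)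
open import Data.Nat using (_≟_)
open import Data.Product using (_,_)
open import Function using (_∘_)
open import Function.Bundles using (_⇔_; mk⇔)
open import Relation.Binary.PropositionalEquality
  using (_≡_; refl; sym; trans; cong; cong₂; subst; module ≡-Reasoning)
open import Relation.Nullary using (yes; no)
open import Algebra.Lattice.Properties.BooleanAlgebra ∨-∧-booleanAlgebra
  using (deMorgan₁; deMorgan₂)

private
  variable
    Γ Δ : List Formula
    φ : Formula

infix 4 _⊨_

_⊨_ : Valuation → Formula → Set
v ⊨ φ = eval v φ ≡ true

eval-dual : ∀ v φ → eval v (dual φ) ≡ not (eval v φ)
eval-dual v (lit (c ⁺)) = refl
eval-dual v (lit (c ⁻)) = sym (not-involutive (v c))
eval-dual v ⊥ᶠ = refl
eval-dual v ⊤ᶠ = refl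
eval-dual v (φ ∧ᶠ ψ) =
  trans (cong₂ _∨_ (eval-dual v φ) (eval-dual v ψ)) (sym (deMorgan₁ (eval v φ) (eval v ψ)))
eval-dual v (φ ∨ᶠ ψ) =
  trans (cong₂ _∧_ (eval-dual v φ) (eval-dual v ψ)) (sym (deMorgan₂ (eval v φ) (eval v ψ)))
eval-dual v (φ ⇒ ψ) = begin
  eval v φ ∧ eval v (dual ψ)            ≡⟨ cong₂ _∧_ (sym (not-involutive (eval v φ))) (eval-dual v ψ) ⟩
  not (not (eval v φ)) ∧ not (eval v ψ) ≡⟨ sym (deMorgan₂ (not (eval v φ)) (eval v ψ)) ⟩
  not (not (eval v φ) ∨ eval v ψ) ∎
  where open ≡-Reasoning

⊨-dual⁺ : ∀ v φ → eval v φ ≡ false → v ⊨ dual φ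
⊨-dual⁺ v φ eq = trans (eval-dual v φ) (cong not eq)

⊨-dual⁻ : ∀ v φ → v ⊨ dual φ → eval v φ ≡ false
⊨-dual⁻ v φ eq = not-injective (trans (sym (eval-dual v φ)) eq)

sound : ∀ v → Γ ⊢ φ → All (v ⊨_) Γ → v ⊨ φ
sound v (assum φ∈Γ) ρ = lookup ρ φ∈Γ
sound v ⊤I ρ = refl
sound v (⊥E d) ρ with () ← sound v d ρ
sound v (⇒I {φ} d) ρ with eval v φ in eq
... | true = sound v d (eq ∷ ρ)
... | false = refl
sound v (⇒E {φ} d e) ρ with eval v φ | sound v d ρ | sound v e ρ
... | true | ψ-true | _ = ψ-true
... | false | _ | ()
sound v (∧I d e) ρ = cong₂ _∧_ (sound v d ρ) (sound v e ρ)
sound v (∧E₁ d) ρ = ∧-conicalˡ _ _ (sound v d ρ)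
sound v (∧E₂ d) ρ = ∧-conicalʳ _ _ (sound v d ρ)
sound v (∨I₁ d) ρ = cong (_∨ _) (sound v d ρ)
sound v (∨I₂ d) ρ = trans (cong (_ ∨_) (sound v d ρ)) (∨-zeroʳ _)
sound v (∨E {φ} d e f) ρ with eval v φ in eq | sound v d ρ
... | true | _ = sound v e (eq ∷ ρ)
... | false | ψ-true = sound v f (ψ-true ∷ ρ)
sound v (DM {φ} d) ρ with eval v φ in eq
... | true with () ← sound v d (eq ∷ ρ)
... | false = ⊨-dual⁺ v φ eq
sound v (EXC {φ} d e) ρ with () ← trans (sym (sound v d ρ)) (⊨-dual⁻ v φ (sound v e ρ))

weaken : Γ ⊆ Δ → Γ ⊢ φ → Δ ⊢ φ
weaken Γ⊆Δ (assum φ∈Γ) = assum (Γ⊆Δ φ∈Γ)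
weaken Γ⊆Δ ⊤I = ⊤I
weaken Γ⊆Δ (⊥E d) = ⊥E (weaken Γ⊆Δ d)
weaken Γ⊆Δ (⇒I d) = ⇒I (weaken (∷⁺ʳ _ Γ⊆Δ) d)
weaken Γ⊆Δ (⇒E d e) = ⇒E (weaken Γ⊆Δ d) (weaken Γ⊆Δ e)
weaken Γ⊆Δ (∧I d e) = ∧I (weaken Γ⊆Δ d) (weaken Γ⊆Δ e)
weaken Γ⊆Δ (∧E₁ d) = ∧E₁ (weaken Γ⊆Δ d)
weaken Γ⊆Δ (∧E₂ d) = ∧E₂ (weaken Γ⊆Δ d)
weaken Γ⊆Δ (∨I₁ d) = ∨I₁ (weaken Γ⊆Δ d)
weaken Γ⊆Δ (∨I₂ d) = ∨I₂ (weaken Γ⊆Δ d)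
weaken Γ⊆Δ (∨E d e f) = ∨E (weaken Γ⊆Δ d) (weaken (∷⁺ʳ _ Γ⊆Δ) e) (weaken (∷⁺ʳ _ Γ⊆Δ) f)
weaken Γ⊆Δ (DM d) = DM (weaken (∷⁺ʳ _ Γ⊆Δ) d)
weaken Γ⊆Δ (EXC d e) = EXC (weaken Γ⊆Δ d) (weaken Γ⊆Δ e)

excluded-middle : ∀ c → Γ ⊢ lit (c ⁺) ∨ᶠ lit (c ⁻)
excluded-middle c =
  DM {φ = lit (c ⁻) ∧ᶠ lit (c ⁺)} (EXC (∧E₂ (assum (here refl))) (∧E₁ (assum (here refl))))

atoms : Formula → List Content
atoms (lit (c ⁺)) = c ∷ []
atoms (lit (c ⁻)) = c ∷ []
atoms ⊥ᶠ = []
atoms ⊤ᶠ = []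
atoms (φ ∧ᶠ ψ) = atoms φ ++ atoms ψ
atoms (φ ∨ᶠ ψ) = atoms φ ++ atoms ψ
atoms (φ ⇒ ψ) = atoms φ ++ atoms ψ

literal : Bool → Content → Formula
literal b c = if b then lit (c ⁺) else lit (c ⁻)

literals : Valuation → List Content → List Formula
literals v = map (λ c → literal (v c) c)

signed : Valuation → Formula → Formula
signed v φ = if eval v φ then φ else dual φ

kalmar : ∀ v φ → literals v (atoms φ) ⊆ Γ → Γ ⊢ signed v φ
kalmar v (lit (c ⁺)) h = assum (h (here refl))
kalmar v (lit (c ⁻)) h with v c | h (here refl)
... | true | c⁺∈Γ = assum c⁺∈Γ
... | false | c⁻∈Γ = assum c⁻∈Γ
kalmar v ⊥ᶠ h = ⊤I
kalmar v ⊤ᶠ h = ⊤I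
kalmar v (φ ∧ᶠ ψ) h with eval v φ | eval v ψ | kalmar v φ (h ∘ map⁺ _ (xs⊆xs++ys _ _))
                                             | kalmar v ψ (h ∘ map⁺ _ (xs⊆ys++xs _ (atoms φ)))
... | true | true | ⊢φ | ⊢ψ = ∧I ⊢φ ⊢ψ
... | true | false | _ | ⊢ψᵈ = ∨I₂ ⊢ψᵈ
... | false | _ | ⊢φᵈ | _ = ∨I₁ ⊢φᵈ
kalmar v (φ ∨ᶠ ψ) h with eval v φ | eval v ψ | kalmar v φ (h ∘ map⁺ _ (xs⊆xs++ys _ _))
                                             | kalmar v ψ (h ∘ map⁺ _ (xs⊆ys++xs _ (atoms φ)))
... | true | _ | ⊢φ | _ = ∨I₁ ⊢φ
... | false | true | _ | ⊢ψ = ∨I₂ ⊢ψ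
... | false | false | ⊢φᵈ | ⊢ψᵈ = ∧I ⊢φᵈ ⊢ψᵈ
kalmar v (φ ⇒ ψ) h with eval v φ | eval v ψ | kalmar v φ (h ∘ map⁺ _ (xs⊆xs++ys _ _))
                                            | kalmar v ψ (h ∘ map⁺ _ (xs⊆ys++xs _ (atoms φ)))
... | true | true | _ | ⊢ψ = ⇒I (weaken (xs⊆x∷xs _ _) ⊢ψ)
... | true | false | ⊢φ | ⊢ψᵈ = ∧I ⊢φ ⊢ψᵈ
... | false | _ | ⊢φᵈ | _ = ⇒I (⊥E (EXC (assum (here refl)) (weaken (xs⊆x∷xs _ _) ⊢φᵈ)))

_[_≔_] : Valuation → Content → Bool → Valuation
(v [ c ≔ b ]) d with d ≟ c
... | yes _ = b
... | no _ = v d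

literals-update : ∀ v c b cs → literals (v [ c ≔ b ]) (c ∷ cs) ⊆ literal b c ∷ literals v cs
literals-update v c b cs x∈ with ∈-map⁻ _ x∈
... | d , d∈c∷cs , refl with d ≟ c
...   | yes refl = here refl
...   | no d≢c = there (∈-map⁺ _ (tail d≢c d∈c∷cs))

discharge-literals : ∀ cs → (∀ v → literals v cs ⊢ φ) → [] ⊢ φ
discharge-literals [] h = h (λ _ → true)
discharge-literals {φ = φ} (c ∷ cs) h =
  discharge-literals cs λ v → ∨E (excluded-middle c) (case v true) (case v false)
  where
  case : ∀ v b → literal b c ∷ literals v cs ⊢ φ
  case v b = weaken (literals-update v c b cs) (h (v [ c ≔ b ]))

complete : ∀ φ → Tautology φ → [] ⊢ φ
complete φ taut = discharge-literals (atoms φ) λ v →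
  subst (literals v (atoms φ) ⊢_)
    (cong (if_then φ else dual φ) (taut v)) (kalmar v φ ⊆-refl)

mainTheorem2 : ∀ (φ : Formula) → ([] ⊢ φ) ⇔ Tautology φ
mainTheorem2 φ = mk⇔ (λ ⊢φ v → sound v ⊢φ []) (complete φ)
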